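{- For every positive integer $n$, let $\alpha_n=D(C_n,-1)$. Then $\alpha_n=3$ if $n\equiv 0\pmod 4$, and $\alpha_n=-1$ otherwise.
   Context: For a simple graph $G$, a dominating set is a set $S$ of vertices such that every vertex is in $S$ or adjacent to a vertex of $S$. With $d(G,i)$ the number of dominating sets of size $i$, the domination polynomial is $D(G,x)=\sum_{i=1}^{|V(G)|} d(G,i)x^i$. $C_n$ is the cycle on $n$ vertices for $n\ge3$, with the convention $C_1=K_1$ and $C_2=K_2$. -}

module Defs where

open import Data.Nat using (ℕ; zero; suc; _%_)
open import Data.Bool using (Bool; true; false; _∧_; _∨_; not; if_then_else_)
open import Data.Fin using (Fin; toℕ)
open import Data.Fin.Properties using (_≟_)
open import Data.Nat.Properties renaming (_≟_ to _≟ℕ_)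
open import Data.Vec using (Vec; []; _∷_; lookup)
open import Data.List using (List; []; _∷_; map; _++_; filter; sum; allFin)
open import Data.List.Relation.Unary.Any using (any?)
open import Data.List.Relation.Unary.All using (all?)
open import Data.Integer using (ℤ; +_; -_; _+_; _*_)
open import Relation.Nullary.Decidable using (⌊_⌋)
open import Relation.Binary.PropositionalEquality using (_≡_; refl; cong)
open import Data.Bool.Properties using (∨-comm)
open import Relation.Nullary using (yes; no)
open import Data.Empty using (⊥-elim)
import Relation.Binary.PropositionalEquality as Eq

record Graph : Set where
  field
    order : ℕ
    adj   : Fin order → Fin order → Bool
    sym   : ∀ i j → adj i j ≡ adj j i
    irr   : ∀ i → adj i i ≡ false

open Graph public

VSet : ℕ → Set
VSet n = Vec Bool n

allSubsets : (n : ℕ) → List (VSet n)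
allSubsets zero = [] ∷ []
allSubsets (suc n) = map (true ∷_) (allSubsets n) ++ map (false ∷_) (allSubsets n)

card : ∀ {n} → VSet n → ℕ
card [] = 0
card (true ∷ s) = suc (card s)
card (false ∷ s) = card s

isDominating : (G : Graph) → VSet (order G) → Bool
isDominating G S = ⌊ all? (λ v → T? (lookup S v ∨ anyIn v)) (allFin (order G)) ⌋
  where
    open import Data.Bool using (T; T?)
    anyIn : Fin (order G) → Bool
    anyIn v = ⌊ any? (λ u → T? (lookup S u ∧ adj G u v)) (allFin (order G)) ⌋

sumℤ : List ℤ → ℤ
sumℤ [] = + 0
sumℤ (x ∷ xs) = x + sumℤ xs

negOnePow : ℕ → ℤ
negOnePow zero = + 1
negOnePow (suc k) = - negOnePow k

dominatingSets : (G : Graph) → List (VSet (order G))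
dominatingSets G = filter (λ S → isDominating G S Data.Bool.≟ true) (allSubsets (order G))

-- D(G, -1) = Σ_i d(G,i) (-1)^i = Σ_{S dominating} (-1)^{|S|}.
-- (The empty set never dominates a nonempty graph, so including i = 0 changes nothing for order ≥ 1.)
DomPolyAtNegOne : Graph → ℤ
DomPolyAtNegOne G = sumℤ (map (λ S → negOnePow (card S)) (dominatingSets G))

succMod : (n : ℕ) → Fin n → Fin n → Bool
succMod (suc m) i j = ⌊ toℕ j ≟ℕ (suc (toℕ i)) % (suc m) ⌋

-- Cycle adjacency on Fin n: i ~ j iff i ≠ j and (j ≡ i+1 or i ≡ j+1 (mod n)).
-- For n = 1 this gives K₁, for n = 2 it gives K₂, for n ≥ 3 the cycle Cₙ.
cycAdj : (n : ℕ) → Fin n → Fin n → Bool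
cycAdj n i j = not ⌊ i ≟ j ⌋ ∧ (succMod n i j ∨ succMod n j i)

private
  neqSym : ∀ {n} (i j : Fin n) → not ⌊ i ≟ j ⌋ ≡ not ⌊ j ≟ i ⌋
  neqSym i j with i ≟ j | j ≟ i
  ... | yes _ | yes _ = refl
  ... | no _  | no _  = refl
  ... | yes p | no q  = ⊥-elim (q (Eq.sym p))
  ... | no p  | yes q = ⊥-elim (p (Eq.sym q))

  neqIrr : ∀ {n} (i : Fin n) → not ⌊ i ≟ i ⌋ ≡ false
  neqIrr i with i ≟ i
  ... | yes _ = refl
  ... | no p  = ⊥-elim (p refl)

C : ℕ → Graph
C n = record
  { order = n
  ; adj   = cycAdj n
  ; sym   = λ i j → Eq.cong₂ _∧_ (neqSym i j) (∨-comm (succMod n i j) (succMod n j i))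
  ; irr   = λ i → Eq.cong (_∧ (succMod n i i ∨ succMod n i i)) (neqIrr i)
  }

module Submission where

-- For n ≥ 3 a set S ⊆ Cₙ, read as a 0/1 word s₀ … sₙ₋₁, dominates exactly
-- when every window of three cyclically consecutive letters contains a 1;
-- equivalently, when the linear word  wrap S = s₀ … sₙ₋₁ s₀ s₁  has no
-- window of three 0s (the predicate `covered`).
--
-- The signed count of such words is computed by a transfer recursion:
-- fixing the first two letters c d of S (which reappear at the end of
-- wrap S), the sum over the k = n - 2 free middle letters is `transfer k c d c d`,
-- obtained by choosing the free letters one at a time.  A finite check of
-- the 16 base cases shows `transfer` is 4-periodic in k, hence so is the
-- total; computing the first four totals finishes the proof.

open import Defs hiding (sym)
open import Data.Nat as ℕ using (ℕ; zero; suc; _%_; _<_; _≤_; z≤n; s≤s)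
open import Data.Nat.Properties
  using (≤-pred; m≤n⇒m<n∨m≡n; n<1+n; <-trans; +-comm; +-identityʳ)
open import Data.Nat.DivMod using (m<n⇒m%n≡m; n%n≡0; [m+n]%n≡m%n)
open import Data.Integer using (ℤ; +_; -[1+_]; -_; _+_)
open import Data.Integer.Properties using (+-identityˡ; +-assoc; neg-distrib-+)
  renaming (+-identityʳ to +ℤ-identityʳ)
open import Data.Bool using (Bool; true; false; _∧_; _∨_; not; if_then_else_; T)
import Data.Bool as Bool
open import Data.Bool.Properties using (T-∧; T-∨)
open import Data.Fin using (Fin; toℕ; fromℕ<) renaming (zero to fzero; suc to fsuc)
open import Data.Fin.Properties using (_≟_; toℕ<n; toℕ-fromℕ<)
open import Data.Vec using ([]; _∷_; lookup) renaming (_++_ to _++ᵛ_)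
open import Data.List using (List; []; _∷_; map; filter; allFin) renaming (_++_ to _++ˡ_)
open import Data.List.Properties using (map-++; map-cong; map-∘)
open import Data.List.Relation.Unary.Any using (satisfied)
open import Data.List.Relation.Unary.All using (universal)
import Data.List.Relation.Unary.All as All
open import Data.List.Membership.Propositional using (lose)
open import Data.List.Membership.Propositional.Properties using (∈-allFin)
open import Data.Product using (Σ; _×_; _,_; proj₁; proj₂)
open import Data.Sum using (_⊎_; inj₁; inj₂; map₂)
open import Data.Unit using (tt)
open import Data.Empty using (⊥-elim)
open import Function using (_∘_; Equivalence)
open import Relation.Nullary using (¬_)
open import Relation.Nullary.Decidable using (⌊_⌋; toWitness; fromWitness; fromWitnessFalse)
open import Relation.Binary.PropositionalEquality
  using (_≡_; _≢_; refl; sym; trans; cong; cong₂; subst; subst₂; module ≡-Reasoning)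
open ≡-Reasoning

guard : Bool → ℤ → ℤ
guard b z = if b then z else + 0

flipIf : Bool → ℤ → ℤ
flipIf true  z = - z
flipIf false z = z

guard-flipIf : ∀ b x z → guard b (flipIf x z) ≡ flipIf x (guard b z)
guard-flipIf true  x     z = refl
guard-flipIf false true  z = refl
guard-flipIf false false z = refl

sumℤ-++ : ∀ (xs ys : List ℤ) → sumℤ (xs ++ˡ ys) ≡ sumℤ xs + sumℤ ys
sumℤ-++ []       ys = sym (+-identityˡ (sumℤ ys))
sumℤ-++ (x ∷ xs) ys = trans (cong (λ t → x + t) (sumℤ-++ xs ys)) (sym (+-assoc x (sumℤ xs) (sumℤ ys)))

sumℤ-flipIf : ∀ {A : Set} x (f : A → ℤ) xs →
              sumℤ (map (flipIf x ∘ f) xs) ≡ flipIf x (sumℤ (map f xs))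
sumℤ-flipIf false f xs       = refl
sumℤ-flipIf true  f []       = refl
sumℤ-flipIf true  f (y ∷ xs) =
  trans (cong (λ t → - f y + t) (sumℤ-flipIf true f xs)) (sym (neg-distrib-+ (f y) (sumℤ (map f xs))))

sumℤ-zero : ∀ {A : Set} (xs : List A) → sumℤ (map (λ _ → + 0) xs) ≡ + 0
sumℤ-zero []       = refl
sumℤ-zero (x ∷ xs) = trans (+-identityˡ _) (sumℤ-zero xs)

sumℤ-filter : ∀ {A : Set} (p : A → Bool) (f : A → ℤ) xs →
              sumℤ (map f (filter (λ x → p x Bool.≟ true) xs))
              ≡ sumℤ (map (λ x → guard (p x) (f x)) xs)
sumℤ-filter p f []       = refl
sumℤ-filter p f (x ∷ xs) with p x
... | true  = cong (λ t → f x + t) (sumℤ-filter p f xs)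
... | false = trans (sumℤ-filter p f xs) (sym (+-identityˡ _))

Σsub : ∀ k → (VSet k → ℤ) → ℤ
Σsub k f = sumℤ (map f (allSubsets k))

sumBool : (Bool → ℤ) → ℤ
sumBool g = g true + g false

Σsub-suc : ∀ k (f : VSet (suc k) → ℤ) → Σsub (suc k) f ≡ sumBool (λ x → Σsub k (λ S → f (x ∷ S)))
Σsub-suc k f = begin
  sumℤ (map f (map (true ∷_) subs ++ˡ map (false ∷_) subs))
    ≡⟨ cong sumℤ (map-++ f (map (true ∷_) subs) (map (false ∷_) subs)) ⟩
  sumℤ (map f (map (true ∷_) subs) ++ˡ map f (map (false ∷_) subs))
    ≡⟨ sumℤ-++ (map f (map (true ∷_) subs)) (map f (map (false ∷_) subs)) ⟩
  sumℤ (map f (map (true ∷_) subs)) + sumℤ (map f (map (false ∷_) subs))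
    ≡⟨ cong₂ _+_ (cong sumℤ (sym (map-∘ subs))) (cong sumℤ (sym (map-∘ subs))) ⟩
  sumBool (λ x → Σsub k (λ S → f (x ∷ S))) ∎
  where subs = allSubsets k

Σsub-cong : ∀ k {f g : VSet k → ℤ} → (∀ S → f S ≡ g S) → Σsub k f ≡ Σsub k g
Σsub-cong k f≗g = cong sumℤ (map-cong f≗g (allSubsets k))

Σsub-flipIf : ∀ k x (f : VSet k → ℤ) → Σsub k (flipIf x ∘ f) ≡ flipIf x (Σsub k f)
Σsub-flipIf k x f = sumℤ-flipIf x f (allSubsets k)

Σsub-guard-∧ : ∀ k e (g : VSet k → Bool) (v : VSet k → ℤ) →
               Σsub k (λ S → guard (e ∧ g S) (v S)) ≡ guard e (Σsub k (λ S → guard (g S) (v S)))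
Σsub-guard-∧ k true  g v = refl
Σsub-guard-∧ k false g v = sumℤ-zero (allSubsets k)

sign : ∀ {k} → VSet k → ℤ
sign S = negOnePow (card S)

guard-sign-∷ : ∀ {k} b x (S : VSet k) → guard b (sign (x ∷ S)) ≡ flipIf x (guard b (sign S))
guard-sign-∷ b true  S = guard-flipIf b true (sign S)
guard-sign-∷ b false S = refl

covered : ∀ {k} → VSet k → Bool
covered []                = true
covered (a ∷ [])          = true
covered (a ∷ b ∷ [])      = true
covered (a ∷ b ∷ c ∷ L)   = (a ∨ b ∨ c) ∧ covered (b ∷ c ∷ L)

-- Letters read at natural-number positions (false beyond the end).
at : ∀ {k} → VSet k → ℕ → Bool
at []      _       = false
at (x ∷ S) zero    = x
at (x ∷ S) (suc i) = at S i

lookup-at : ∀ {k} (S : VSet k) (v : Fin k) → lookup S v ≡ at S (toℕ v)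
lookup-at (x ∷ S) fzero    = refl
lookup-at (x ∷ S) (fsuc v) = lookup-at S v

at-++ˡ : ∀ {k l} (S : VSet k) (U : VSet l) i → i < k → at (S ++ᵛ U) i ≡ at S i
at-++ˡ (x ∷ S) U zero    _       = refl
at-++ˡ (x ∷ S) U (suc i) (s≤s p) = at-++ˡ S U i p

at-++ʳ : ∀ {k l} (S : VSet k) (U : VSet l) j → at (S ++ᵛ U) (k ℕ.+ j) ≡ at U j
at-++ʳ []      U j = refl
at-++ʳ (x ∷ S) U j = at-++ʳ S U j

window : ∀ {k} → VSet k → ℕ → Bool
window L i = at L i ∨ at L (suc i) ∨ at L (suc (suc i))

inWindow₀ : ∀ {k} (L : VSet k) i → T (at L i) → T (window L i)
inWindow₀ L i t = Equivalence.from (T-∨ {at L i}) (inj₁ t)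

inWindow₁ : ∀ {k} (L : VSet k) i → T (at L (suc i)) → T (window L i)
inWindow₁ L i t = Equivalence.from (T-∨ {at L i}) (inj₂ (Equivalence.from (T-∨ {at L (suc i)}) (inj₁ t)))

inWindow₂ : ∀ {k} (L : VSet k) i → T (at L (suc (suc i))) → T (window L i)
inWindow₂ L i t = Equivalence.from (T-∨ {at L i}) (inj₂ (Equivalence.from (T-∨ {at L (suc i)}) (inj₂ t)))

windowCases : ∀ {k} (L : VSet k) i → T (window L i) →
              T (at L i) ⊎ T (at L (suc i)) ⊎ T (at L (suc (suc i)))
windowCases L i t with Equivalence.to T-∨ t
... | inj₁ t₀ = inj₁ t₀
... | inj₂ t₁₂ = inj₂ (Equivalence.to T-∨ t₁₂)

covered⇒window : ∀ {k} (L : VSet k) → T (covered L) → ∀ i → suc (suc i) < k → T (window L i)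
covered⇒window (a ∷ [])         h i       (s≤s ())
covered⇒window (a ∷ b ∷ [])     h i       (s≤s (s≤s ()))
covered⇒window (a ∷ b ∷ c ∷ L) h zero    _       = Equivalence.to T-∧ h .proj₁
covered⇒window (a ∷ b ∷ c ∷ L) h (suc i) (s≤s p) =
  covered⇒window (b ∷ c ∷ L) (Equivalence.to T-∧ h .proj₂) i p

window⇒covered : ∀ {k} (L : VSet k) → (∀ i → suc (suc i) < k → T (window L i)) → T (covered L)
window⇒covered []              _ = tt
window⇒covered (a ∷ [])        _ = tt
window⇒covered (a ∷ b ∷ [])    _ = tt
window⇒covered (a ∷ b ∷ c ∷ L) W = Equivalence.from T-∧
  (W 0 (s≤s (s≤s (s≤s z≤n))) , window⇒covered (b ∷ c ∷ L) (λ i p → W (suc i) (s≤s p)))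

-- transfer k a b c d is the signed count of the words S of length k for
-- which  a b S c d  is covered; the recursion chooses the first letter x of S.
transfer : ℕ → Bool → Bool → Bool → Bool → ℤ
transfer zero    a b c d = guard (covered (a ∷ b ∷ c ∷ d ∷ [])) (+ 1)
transfer (suc k) a b c d = sumBool (λ x → guard (a ∨ b ∨ x) (flipIf x (transfer k b x c d)))

transfer-sum : ∀ k a b c d →
  Σsub k (λ S → guard (covered (a ∷ b ∷ (S ++ᵛ c ∷ d ∷ []))) (sign S)) ≡ transfer k a b c d
transfer-sum zero    a b c d = +ℤ-identityʳ _
transfer-sum (suc k) a b c d = trans (Σsub-suc k _) (cong₂ _+_ (firstLetter true) (firstLetter false))
  where
  tail-covered : Bool → VSet k → Bool
  tail-covered x S = covered (b ∷ x ∷ (S ++ᵛ c ∷ d ∷ []))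

  firstLetter : ∀ x → Σsub k (λ S → guard ((a ∨ b ∨ x) ∧ tail-covered x S) (sign (x ∷ S)))
                      ≡ guard (a ∨ b ∨ x) (flipIf x (transfer k b x c d))
  firstLetter x = begin
    Σsub k (λ S → guard ((a ∨ b ∨ x) ∧ tail-covered x S) (sign (x ∷ S)))
      ≡⟨ Σsub-guard-∧ k (a ∨ b ∨ x) (tail-covered x) (sign ∘ (x ∷_)) ⟩
    guard (a ∨ b ∨ x) (Σsub k (λ S → guard (tail-covered x S) (sign (x ∷ S))))
      ≡⟨ cong (guard _) (Σsub-cong k (λ S → guard-sign-∷ (tail-covered x S) x S)) ⟩
    guard (a ∨ b ∨ x) (Σsub k (λ S → flipIf x (guard (tail-covered x S) (sign S))))
      ≡⟨ cong (guard _) (Σsub-flipIf k x _) ⟩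
    guard (a ∨ b ∨ x) (flipIf x (Σsub k (λ S → guard (tail-covered x S) (sign S))))
      ≡⟨ cong (guard _ ∘ flipIf x) (transfer-sum k b x c d) ⟩
    guard (a ∨ b ∨ x) (flipIf x (transfer k b x c d)) ∎

-- Period 4: a finite check at k = 0, propagated by the recursion.
transfer-periodic : ∀ k a b c d → transfer (4 ℕ.+ k) a b c d ≡ transfer k a b c d
transfer-periodic zero true  true  true  true  = refl
transfer-periodic zero true  true  true  false = refl
transfer-periodic zero true  true  false true  = refl
transfer-periodic zero true  true  false false = refl
transfer-periodic zero true  false true  true  = refl
transfer-periodic zero true  false true  false = refl
transfer-periodic zero true  false false true  = refl
transfer-periodic zero true  false false false = refl
transfer-periodic zero false true  true  true  = refl
transfer-periodic zero false true  true  false = refl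
transfer-periodic zero false true  false true  = refl
transfer-periodic zero false true  false false = refl
transfer-periodic zero false false true  true  = refl
transfer-periodic zero false false true  false = refl
transfer-periodic zero false false false true  = refl
transfer-periodic zero false false false false = refl
transfer-periodic (suc k) a b c d
  rewrite transfer-periodic k b true c d | transfer-periodic k b false c d = refl

-- Appending the first two letters turns cyclic windows into linear ones.
wrap : ∀ {k} → VSet k → VSet (k ℕ.+ 2)
wrap S = S ++ᵛ (at S 0 ∷ at S 1 ∷ [])

at-wrap-< : ∀ {k} (S : VSet k) j → j < k → at (wrap S) j ≡ at S j
at-wrap-< S j j<k = at-++ˡ S _ j j<k

at-wrap-k : ∀ {k} (S : VSet k) → at (wrap S) k ≡ at S 0
at-wrap-k {k} S = trans (cong (at (wrap S)) (sym (+-identityʳ k))) (at-++ʳ S (at S 0 ∷ at S 1 ∷ []) 0)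

at-wrap-1+k : ∀ {k} (S : VSet k) → at (wrap S) (suc k) ≡ at S 1
at-wrap-1+k {k} S = trans (cong (at (wrap S)) (+-comm 1 k)) (at-++ʳ S (at S 0 ∷ at S 1 ∷ []) 1)

-- The signed count of cyclic words of length k + 2 without three cyclically
-- consecutive zeros, split by the first two letters c d.
cyclicTotal : ℕ → ℤ
cyclicTotal k = sumBool (λ c → sumBool (λ d → flipIf c (flipIf d (transfer k c d c d))))

cyclicTotal-sum : ∀ k → Σsub (suc (suc k)) (λ S → guard (covered (wrap S)) (sign S)) ≡ cyclicTotal k
cyclicTotal-sum k =
  trans (Σsub-suc (suc k) _) (cong₂ _+_ (firstTwo true) (firstTwo false))
  where
  prefixed : ∀ c d → Σsub k (λ S → guard (covered (wrap (c ∷ d ∷ S))) (sign (c ∷ d ∷ S)))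
                     ≡ flipIf c (flipIf d (transfer k c d c d))
  prefixed c d = begin
    Σsub k (λ S → guard (cov S) (sign (c ∷ d ∷ S)))
      ≡⟨ Σsub-cong k (λ S → trans (guard-sign-∷ (cov S) c (d ∷ S))
                                  (cong (flipIf c) (guard-sign-∷ (cov S) d S))) ⟩
    Σsub k (λ S → flipIf c (flipIf d (guard (cov S) (sign S))))
      ≡⟨ Σsub-flipIf k c _ ⟩
    flipIf c (Σsub k (λ S → flipIf d (guard (cov S) (sign S))))
      ≡⟨ cong (flipIf c) (Σsub-flipIf k d _) ⟩
    flipIf c (flipIf d (Σsub k (λ S → guard (cov S) (sign S))))
      ≡⟨ cong (flipIf c ∘ flipIf d) (transfer-sum k c d c d) ⟩
    flipIf c (flipIf d (transfer k c d c d)) ∎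
    where
    cov : VSet k → Bool
    cov S = covered (wrap (c ∷ d ∷ S))

  firstTwo : ∀ c → Σsub (suc k) (λ S → guard (covered (wrap (c ∷ S))) (sign (c ∷ S)))
                   ≡ sumBool (λ d → flipIf c (flipIf d (transfer k c d c d)))
  firstTwo c = trans (Σsub-suc k _) (cong₂ _+_ (prefixed c true) (prefixed c false))

cyclicTotal-periodic : ∀ k → cyclicTotal (4 ℕ.+ k) ≡ cyclicTotal k
cyclicTotal-periodic k
  rewrite transfer-periodic k true true true true | transfer-periodic k true false true false
        | transfer-periodic k false true false true | transfer-periodic k false false false false
  = refl

Claim : ℕ → ℤ → Set
Claim n z = (n % 4 ≡ 0 → z ≡ + 3) × (n % 4 ≢ 0 → z ≡ -[1+ 0 ])

Claim-periodic : ∀ n z → Claim n z → Claim (n ℕ.+ 4) z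
Claim-periodic n z (if4∣ , if4∤) =
  (λ h → if4∣ (trans (sym mod4) h)) , (λ h → if4∤ (λ h' → h (trans mod4 h')))
  where
  mod4 : (n ℕ.+ 4) % 4 ≡ n % 4
  mod4 = [m+n]%n≡m%n n 4

cyclicTotal-claim : ∀ m → Claim (3 ℕ.+ m) (cyclicTotal (suc m))
cyclicTotal-claim 0 = (λ ()) , (λ _ → refl)
cyclicTotal-claim 1 = (λ _ → refl) , (λ h → ⊥-elim (h refl))
cyclicTotal-claim 2 = (λ ()) , (λ _ → refl)
cyclicTotal-claim 3 = (λ ()) , (λ _ → refl)
cyclicTotal-claim (suc (suc (suc (suc m)))) =
  subst₂ Claim (+-comm (3 ℕ.+ m) 4) (sym (cyclicTotal-periodic (suc m)))
    (Claim-periodic (3 ℕ.+ m) _ (cyclicTotal-claim m))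

CycSucc : ℕ → ℕ → ℕ → Set
CycSucc n i j = (j ≡ suc i) ⊎ (suc i ≡ n × j ≡ 0)

CycAdj : ℕ → ℕ → ℕ → Set
CycAdj n i j = CycSucc n i j ⊎ CycSucc n j i

succMod⇒CycSucc : ∀ {n} (u v : Fin (suc n)) →
                  T (succMod (suc n) u v) → CycSucc (suc n) (toℕ u) (toℕ v)
succMod⇒CycSucc {n} u v h with m≤n⇒m<n∨m≡n (toℕ<n u)
... | inj₁ u+1<n = inj₁ (trans (toWitness h) (m<n⇒m%n≡m u+1<n))
... | inj₂ u+1≡n = inj₂ (u+1≡n , trans (toWitness h) (trans (cong (_% suc n) u+1≡n) (n%n≡0 (suc n))))

CycSucc⇒succMod : ∀ {n} (u v : Fin (suc n)) →
                  CycSucc (suc n) (toℕ u) (toℕ v) → T (succMod (suc n) u v)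
CycSucc⇒succMod {n} u v (inj₁ v≡u+1) =
  fromWitness (trans v≡u+1 (sym (m<n⇒m%n≡m (subst (_< suc n) v≡u+1 (toℕ<n v)))))
CycSucc⇒succMod {n} u v (inj₂ (u+1≡n , v≡0)) =
  fromWitness (trans v≡0 (sym (trans (cong (_% suc n) u+1≡n) (n%n≡0 (suc n)))))

-- Adjacency in Cₙ implies CycAdj; the converse needs n ≥ 3 (below).
cycAdj⇒CycAdj : ∀ {n} (u v : Fin (suc n)) → T (cycAdj (suc n) u v) → CycAdj (suc n) (toℕ u) (toℕ v)
cycAdj⇒CycAdj u v h with Equivalence.to T-∨ (proj₂ (Equivalence.to (T-∧ {not ⌊ u ≟ v ⌋}) h))
... | inj₁ uv = inj₁ (succMod⇒CycSucc u v uv)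
... | inj₂ vu = inj₂ (succMod⇒CycSucc v u vu)

CycSucc-irreflexive : ∀ m i → ¬ CycSucc (3 ℕ.+ m) i i
CycSucc-irreflexive m i    (inj₁ ())
CycSucc-irreflexive m zero (inj₂ (() , _))

CycAdj-irreflexive : ∀ m i → ¬ CycAdj (3 ℕ.+ m) i i
CycAdj-irreflexive m i (inj₁ ii) = CycSucc-irreflexive m i ii
CycAdj-irreflexive m i (inj₂ ii) = CycSucc-irreflexive m i ii

CycAdj⇒cycAdj : ∀ m (u v : Fin (3 ℕ.+ m)) → CycAdj (3 ℕ.+ m) (toℕ u) (toℕ v) → T (cycAdj (3 ℕ.+ m) u v)
CycAdj⇒cycAdj m u v uv = Equivalence.from T-∧ (fromWitnessFalse u≢v , Equivalence.from T-∨ (succ uv))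
  where
  u≢v : u ≢ v
  u≢v u≡v = CycAdj-irreflexive m (toℕ v) (subst (λ w → CycAdj (3 ℕ.+ m) (toℕ w) (toℕ v)) u≡v uv)

  succ : CycAdj (3 ℕ.+ m) (toℕ u) (toℕ v) → T (succMod (3 ℕ.+ m) u v) ⊎ T (succMod (3 ℕ.+ m) v u)
  succ (inj₁ u→v) = inj₁ (CycSucc⇒succMod u v u→v)
  succ (inj₂ v→u) = inj₂ (CycSucc⇒succMod v u v→u)

Dominates : (G : Graph) → VSet (order G) → Set
Dominates G S = ∀ v → T (lookup S v) ⊎ Σ (Fin (order G)) (λ u → T (lookup S u) × T (adj G u v))

isDominating⇒Dominates : ∀ G S → T (isDominating G S) → Dominates G S
isDominating⇒Dominates G S h v with Equivalence.to T-∨ (All.lookup (toWitness h) (∈-allFin v))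
... | inj₁ v∈S = inj₁ v∈S
... | inj₂ nbr with satisfied (toWitness nbr)
...   | u , u∈S∧uv = inj₂ (u , Equivalence.to T-∧ u∈S∧uv)

Dominates⇒isDominating : ∀ G S → Dominates G S → T (isDominating G S)
Dominates⇒isDominating G S D = fromWitness (universal
  (λ v → Equivalence.from (T-∨ {lookup S v})
           (map₂ (λ (u , u∈S , uv) → fromWitness (lose (∈-allFin u) (Equivalence.from T-∧ (u∈S , uv))))
                 (D v)))
  (allFin (order G)))

T-injective : ∀ {a b} → (T a → T b) → (T b → T a) → a ≡ b
T-injective {true}  {true}  _ _ = refl
T-injective {true}  {false} f _ = ⊥-elim (f tt)
T-injective {false} {true}  _ g = ⊥-elim (g tt)
T-injective {false} {false} _ _ = refl

module CycleDomination (m : ℕ) where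

  n : ℕ
  n = 3 ℕ.+ m

  Dominatesℕ : VSet n → Set
  Dominatesℕ S = ∀ j → j < n → T (at S j) ⊎ Σ ℕ (λ u → u < n × T (at S u) × CycAdj n u j)

  at-fromℕ< : ∀ (S : VSet n) {j} (j<n : j < n) → lookup S (fromℕ< j<n) ≡ at S j
  at-fromℕ< S j<n = trans (lookup-at S (fromℕ< j<n)) (cong (at S) (toℕ-fromℕ< j<n))

  Dominates⇒Dominatesℕ : ∀ (S : VSet n) → Dominates (C n) S → Dominatesℕ S
  Dominates⇒Dominatesℕ S D j j<n with D (fromℕ< j<n)
  ... | inj₁ j∈S = inj₁ (subst T (at-fromℕ< S j<n) j∈S)
  ... | inj₂ (u , u∈S , uj) = inj₂ (toℕ u , toℕ<n u , subst T (lookup-at S u) u∈S ,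
          subst (CycAdj n (toℕ u)) (toℕ-fromℕ< j<n) (cycAdj⇒CycAdj u (fromℕ< j<n) uj))

  Dominatesℕ⇒Dominates : ∀ (S : VSet n) → Dominatesℕ S → Dominates (C n) S
  Dominatesℕ⇒Dominates S D v with D (toℕ v) (toℕ<n v)
  ... | inj₁ v∈S = inj₁ (subst T (sym (lookup-at S v)) v∈S)
  ... | inj₂ (u , u<n , u∈S , uv) = inj₂ (fromℕ< u<n , subst T (sym (at-fromℕ< S u<n)) u∈S ,
          CycAdj⇒cycAdj m (fromℕ< u<n) v (subst (λ x → CycAdj n x (toℕ v)) (sym (toℕ-fromℕ< u<n)) uv))

  -- Window i of wrap S is the closed neighbourhood of vertex i + 1 (mod n),
  -- so it contains a member of S when that vertex is dominated.
  Dominatesℕ⇒window : ∀ (S : VSet n) → Dominatesℕ S → ∀ i → i < n → T (window (wrap S) i)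
  Dominatesℕ⇒window S D i i<n with m≤n⇒m<n∨m≡n i<n
  Dominatesℕ⇒window S D i i<n | inj₁ i+1<n with D (suc i) i+1<n
  ... | inj₁ t = inWindow₁ (wrap S) i (subst T (sym (at-wrap-< S (suc i) i+1<n)) t)
  ... | inj₂ (_ , _   , t , inj₁ (inj₁ refl))       = inWindow₀ (wrap S) i (subst T (sym (at-wrap-< S i i<n)) t)
  ... | inj₂ (_ , _   , t , inj₁ (inj₂ (_ , ())))
  ... | inj₂ (_ , u<n , t , inj₂ (inj₁ refl))       = inWindow₂ (wrap S) i (subst T (sym (at-wrap-< S _ u<n)) t)
  ... | inj₂ (_ , _   , t , inj₂ (inj₂ (refl , refl))) = inWindow₂ (wrap S) i (subst T (sym (at-wrap-k S)) t)
  Dominatesℕ⇒window S D i i<n | inj₂ refl with D 0 (s≤s z≤n)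
  ... | inj₁ t = inWindow₁ (wrap S) i (subst T (sym (at-wrap-k S)) t)
  ... | inj₂ (_ , _ , t , inj₁ (inj₁ ()))
  ... | inj₂ (_ , _ , t , inj₁ (inj₂ (refl , _)))   = inWindow₀ (wrap S) i (subst T (sym (at-wrap-< S i i<n)) t)
  ... | inj₂ (_ , _ , t , inj₂ (inj₁ refl))         = inWindow₂ (wrap S) i (subst T (sym (at-wrap-1+k S)) t)
  ... | inj₂ (_ , _ , t , inj₂ (inj₂ (() , _)))

  -- Conversely, vertex 0 is the centre of window n - 1 and vertex i + 1 of window i.
  window⇒Dominatesℕ : ∀ (S : VSet n) → (∀ i → i < n → T (window (wrap S) i)) → Dominatesℕ S
  window⇒Dominatesℕ S W zero _ with windowCases (wrap S) (suc (suc m)) (W (suc (suc m)) (n<1+n _))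
  ... | inj₁ t        = inj₂ (suc (suc m) , n<1+n _ , subst T (at-wrap-< S _ (n<1+n _)) t , inj₁ (inj₂ (refl , refl)))
  ... | inj₂ (inj₁ t) = inj₁ (subst T (at-wrap-k S) t)
  ... | inj₂ (inj₂ t) = inj₂ (1 , s≤s (s≤s z≤n) , subst T (at-wrap-1+k S) t , inj₂ (inj₁ refl))
  window⇒Dominatesℕ S W (suc i) i+1<n with <-trans (n<1+n i) i+1<n
  ... | i<n with windowCases (wrap S) i (W i i<n)
  ... | inj₁ t        = inj₂ (i , i<n , subst T (at-wrap-< S i i<n) t , inj₁ (inj₁ refl))
  ... | inj₂ (inj₁ t) = inj₁ (subst T (at-wrap-< S (suc i) i+1<n) t)
  ... | inj₂ (inj₂ t) with m≤n⇒m<n∨m≡n i+1<n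
  ...   | inj₁ i+2<n = inj₂ (suc (suc i) , i+2<n , subst T (at-wrap-< S _ i+2<n) t , inj₂ (inj₁ refl))
  ...   | inj₂ refl  = inj₂ (0 , s≤s z≤n , subst T (at-wrap-k S) t , inj₂ (inj₂ (refl , refl)))

  -- The complete windows of wrap S are exactly those starting at positions i < n.
  covered-wrap⇒windows : ∀ (S : VSet n) → T (covered (wrap S)) → ∀ i → i < n → T (window (wrap S) i)
  covered-wrap⇒windows S h i i<n =
    covered⇒window (wrap S) h i (subst (suc (suc (suc i)) ≤_) (+-comm 2 n) (s≤s (s≤s i<n)))

  windows⇒covered-wrap : ∀ (S : VSet n) → (∀ i → i < n → T (window (wrap S) i)) → T (covered (wrap S))
  windows⇒covered-wrap S W = window⇒covered (wrap S) (λ i i+2<n+2 →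
    W i (≤-pred (≤-pred (subst (suc (suc (suc i)) ≤_) (+-comm n 2) i+2<n+2))))

  isDominating≡covered-wrap : ∀ (S : VSet n) → isDominating (C n) S ≡ covered (wrap S)
  isDominating≡covered-wrap S = T-injective
    (λ h → windows⇒covered-wrap S
             (Dominatesℕ⇒window S (Dominates⇒Dominatesℕ S (isDominating⇒Dominates (C n) S h))))
    (λ h → Dominates⇒isDominating (C n) S
             (Dominatesℕ⇒Dominates S (window⇒Dominatesℕ S (covered-wrap⇒windows S h))))

domPoly-cycle : ∀ m → DomPolyAtNegOne (C (3 ℕ.+ m)) ≡ cyclicTotal (suc m)
domPoly-cycle m = begin
  DomPolyAtNegOne (C n)
    ≡⟨ sumℤ-filter (isDominating (C n)) sign (allSubsets n) ⟩
  Σsub n (λ S → guard (isDominating (C n) S) (sign S))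
    ≡⟨ Σsub-cong n (λ S → cong (λ b → guard b (sign S)) (isDominating≡covered-wrap S)) ⟩
  Σsub n (λ S → guard (covered (wrap S)) (sign S))
    ≡⟨ cyclicTotal-sum (suc m) ⟩
  cyclicTotal (suc m) ∎
  where open CycleDomination m

lemma5 : ∀ (n : ℕ) → (suc n % 4 ≡ 0 → DomPolyAtNegOne (C (suc n)) ≡ + 3)
                   × (suc n % 4 ≢ 0 → DomPolyAtNegOne (C (suc n)) ≡ -[1+ 0 ])
lemma5 zero          = (λ ()) , (λ _ → refl)
lemma5 (suc zero)    = (λ ()) , (λ _ → refl)
lemma5 (suc (suc m)) = subst (Claim (3 ℕ.+ m)) (sym (domPoly-cycle m)) (cyclicTotal-claim m)
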